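{- Let $n$ be a positive integer and let $1=a_1<a_2<\cdots<a_k=n$ be all the positive divisors of $n$. If $a_{i+1}\le 2a_i$ for all $1\le i\le k-1$ and $\sigma(n)$ is even, then $n$ is a Zumkeller number.
   Context: $\sigma(n)$ denotes the sum of all positive divisors of $n$. A positive integer $n$ is a Zumkeller number if the set of all positive divisors of $n$ can be partitioned into two disjoint parts whose sums are equal. -}

module Defs where

open import Data.Nat using (ℕ; suc; _*_; _≤_)
open import Data.Nat.Divisibility using (_∣_; _∣?_)
open import Data.List using (List; filter; map; upTo)
open import Data.Nat.ListAction using (sum)
open import Data.List.Relation.Unary.Linked using (Linked)
open import Data.Bool using (Bool; true; false; T; not)
open import Data.Bool using () renaming (T? to T?)
open import Data.Product using (∃)
open import Relation.Binary.PropositionalEquality using (_≡_)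
open import Function using (_∘_)

divisors : ℕ → List ℕ
divisors n = filter (_∣? n) (map suc (upTo n))

σ : ℕ → ℕ
σ n = sum (divisors n)

part : (ℕ → Bool) → Bool → List ℕ → List ℕ
part c true  xs = filter (T? ∘ c) xs
part c false xs = filter (T? ∘ not ∘ c) xs

-- n is Zumkeller: the divisor set can be split into two disjoint parts
-- (those labelled true / false by c) with equal sums.
Zumkeller : ℕ → Set
Zumkeller n = ∃ λ (c : ℕ → Bool) →
  sum (part c true (divisors n)) ≡ sum (part c false (divisors n))

DoublingDivisors : ℕ → Set
DoublingDivisors n = Linked (λ a b → b ≤ 2 * a) (divisors n)

module Submission where

-- Call a list x₁, x₂, … of naturals *gapless above s*
-- when every element satisfies  xᵢ ≤ 1 + s + (x₁ + ⋯ + xᵢ₋₁).  For such a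
-- list of distinct values, every t ≤ s + Σ xᵢ is a sub-sum of the list plus
-- a remainder u ≤ s (induction on the list: the remainder left by the tail
-- either is already ≤ s, or is ≥ s + 1 ≥ x₁ and absorbs x₁).  With s = 0
-- this says every t ≤ Σ xᵢ is a sub-sum.
--
-- The divisors 1 = a₁ < a₂ < ⋯ < a_k = n with a_{i+1} ≤ 2aᵢ are gapless
-- above 0: by induction aᵢ ≤ 1 + (a₁ + ⋯ + aᵢ₋₁), hence
-- a_{i+1} ≤ 2aᵢ ≤ 1 + (a₁ + ⋯ + aᵢ).  If σ(n) = 2q, the sub-sum q is
-- realised by a labelling of the divisors; the complementary part then sums
-- to σ(n) − q = q, so n is Zumkeller.

open import Defs
open import Data.Nat using (ℕ; NonZero; suc; _+_; _*_; _∸_; _≤_; _<_; _≟_; _≤?_)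
open import Data.Nat.Properties
open import Algebra.Properties.CommutativeSemigroup +-commutativeSemigroup using (x∙yz≈y∙xz)
open import Data.Nat.Divisibility using (_∣_; _∣?_; divides; 1∣_)
open import Data.Nat.ListAction using (sum)
open import Data.List using (List; []; _∷_)
open import Data.List.Properties using (filter-accept)
open import Data.List.Relation.Unary.All using (All; []; _∷_)
open import Data.List.Relation.Unary.AllPairs as AllPairs using (AllPairs; _∷_)
open import Data.List.Relation.Unary.Linked using (Linked; _∷_)
import Data.List.Relation.Unary.Linked.Properties as Linked
open import Data.Bool using (Bool; true; false; if_then_else_)
open import Data.Product using (∃; ∃₂; _,_; _×_; proj₁; proj₂)
open import Function using (_on_)
open import Relation.Binary.PropositionalEquality
open import Relation.Nullary using (yes; no; does)
open import Relation.Nullary.Decidable using (dec-true; dec-false)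

partSum : (ℕ → Bool) → Bool → List ℕ → ℕ
partSum c b xs = sum (part c b xs)

partSum-split : ∀ c xs → partSum c true xs + partSum c false xs ≡ sum xs
partSum-split c [] = refl
partSum-split c (x ∷ xs) with c x
... | true  = trans (+-assoc x _ _) (cong (x +_) (partSum-split c xs))
... | false = begin
    partSum c true xs + (x + partSum c false xs) ≡⟨ x∙yz≈y∙xz (partSum c true xs) x (partSum c false xs) ⟩
    x + (partSum c true xs + partSum c false xs) ≡⟨ cong (x +_) (partSum-split c xs) ⟩
    x + sum xs                                   ∎
  where open ≡-Reasoning

relabel : ℕ → Bool → (ℕ → Bool) → ℕ → Bool
relabel x b c v = if does (v ≟ x) then b else c v

partSum-relabel-fresh : ∀ x b c {xs} → All (x ≢_) xs →
                        partSum (relabel x b c) true xs ≡ partSum c true xs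
partSum-relabel-fresh x b c [] = refl
partSum-relabel-fresh x b c {v ∷ _} (x≢v ∷ x∉xs)
  rewrite dec-false (v ≟ x) (≢-sym x≢v) with c v
... | true  = cong (v +_) (partSum-relabel-fresh x b c x∉xs)
... | false = partSum-relabel-fresh x b c x∉xs

partSum-relabel-true : ∀ x c {xs} → All (x ≢_) xs →
                       partSum (relabel x true c) true (x ∷ xs) ≡ x + partSum c true xs
partSum-relabel-true x c x∉xs rewrite dec-true (x ≟ x) refl =
  cong (x +_) (partSum-relabel-fresh x true c x∉xs)

partSum-relabel-false : ∀ x c {xs} → All (x ≢_) xs →
                        partSum (relabel x false c) true (x ∷ xs) ≡ partSum c true xs
partSum-relabel-false x c x∉xs rewrite dec-true (x ≟ x) refl =
  partSum-relabel-fresh x false c x∉xs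

data Gapless : ℕ → List ℕ → Set where
  []  : ∀ {s} → Gapless s []
  _∷_ : ∀ {s x xs} → x ≤ suc s → Gapless (s + x) xs → Gapless s (x ∷ xs)

absorb : ∀ x S u → x ≤ u → x + S + (u ∸ x) ≡ S + u
absorb x S u x≤u = begin
  x + S + (u ∸ x)   ≡⟨ cong (_+ (u ∸ x)) (+-comm x S) ⟩
  S + x + (u ∸ x)   ≡⟨ +-assoc S x (u ∸ x) ⟩
  S + (x + (u ∸ x)) ≡⟨ cong (S +_) (m+[n∸m]≡n x≤u) ⟩
  S + u             ∎
  where open ≡-Reasoning

representable : ∀ {s xs} → Gapless s xs → AllPairs _≢_ xs → ∀ t → t ≤ s + sum xs →
                ∃₂ λ c u → u ≤ s × partSum c true xs + u ≡ t
representable {s} [] _ t t≤s = (λ _ → false) , t , subst (t ≤_) (+-identityʳ s) t≤s , refl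
representable {s} {x ∷ xs} (x≤1+s ∷ gapless) (x∉xs ∷ distinct) t t≤
  with representable gapless distinct t (subst (t ≤_) (sym (+-assoc s x (sum xs))) t≤)
... | c , u , u≤s+x , sum+u≡t with u ≤? s
...   | yes u≤s = relabel x false c , u , u≤s ,
          trans (cong (_+ u) (partSum-relabel-false x c x∉xs)) sum+u≡t
...   | no u≰s  = relabel x true c , u ∸ x , u∸x≤s , (begin
          partSum (relabel x true c) true (x ∷ xs) + (u ∸ x)
            ≡⟨ cong (_+ (u ∸ x)) (partSum-relabel-true x c x∉xs) ⟩
          x + partSum c true xs + (u ∸ x)
            ≡⟨ absorb x (partSum c true xs) u (≤-trans x≤1+s (≰⇒> u≰s)) ⟩
          partSum c true xs + u
            ≡⟨ sum+u≡t ⟩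
          t ∎)
  where
    open ≡-Reasoning
    u∸x≤s : u ∸ x ≤ s
    u∸x≤s = ≤-trans (∸-monoˡ-≤ x u≤s+x) (≤-reflexive (m+n∸n≡m s x))

subSum : ∀ {xs} → Gapless 0 xs → AllPairs _≢_ xs → ∀ t → t ≤ sum xs →
         ∃ λ c → partSum c true xs ≡ t
subSum {xs} gapless distinct t t≤ with representable gapless distinct t t≤
... | c , u , u≤0 , sum+u≡t = c , (begin
  partSum c true xs     ≡⟨ sym (+-identityʳ _) ⟩
  partSum c true xs + 0 ≡⟨ cong (partSum c true xs +_) (sym (n≤0⇒n≡0 u≤0)) ⟩
  partSum c true xs + u ≡⟨ sum+u≡t ⟩
  t                     ∎)
  where open ≡-Reasoning

Doubling : ℕ → ℕ → Set
Doubling a b = b ≤ 2 * a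

doubling⇒gapless : ∀ s x xs → x ≤ suc s → Linked Doubling (x ∷ xs) → Gapless s (x ∷ xs)
doubling⇒gapless s x [] x≤1+s _ = x≤1+s ∷ []
doubling⇒gapless s x (y ∷ ys) x≤1+s (y≤2x ∷ doubling) =
  x≤1+s ∷ doubling⇒gapless (s + x) y ys y≤1+s+x doubling
  where
    open ≤-Reasoning
    y≤1+s+x : y ≤ suc (s + x)
    y≤1+s+x = begin
      y          ≤⟨ y≤2x ⟩
      2 * x      ≡⟨ cong (x +_) (+-identityʳ x) ⟩
      x + x      ≤⟨ +-monoˡ-≤ x x≤1+s ⟩
      suc s + x  ∎

divisors-increasing : ∀ n → Linked _<_ (divisors n)
divisors-increasing n = Linked.filter⁺ (_∣? n) <-trans
  (Linked.map⁺ (Linked.applyUpTo⁺₂ {R = _<_ on suc} (λ i → i) n (λ i → n<1+n (suc i))))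

divisors-head : ∀ m → ∃ λ ds → divisors (suc m) ≡ 1 ∷ ds
divisors-head m = _ , filter-accept (_∣? suc m) (1∣ suc m)

divisors-gapless : ∀ m → DoublingDivisors (suc m) → Gapless 0 (divisors (suc m))
divisors-gapless m doubling with divisors-head m
... | ds , ds≡ rewrite ds≡ = doubling⇒gapless 0 1 ds ≤-refl doubling

divisors-distinct : ∀ n → AllPairs _≢_ (divisors n)
divisors-distinct n = AllPairs.map <⇒≢ (Linked.Linked⇒AllPairs <-trans (divisors-increasing n))

mainTheorem7 : (n : ℕ) → NonZero n → DoublingDivisors n → 2 ∣ σ n → Zumkeller n
mainTheorem7 (suc m) _ doubling (divides q σ≡q*2) = c , trans trueSum≡q (sym falseSum≡q)
  where
    ds : List ℕ
    ds = divisors (suc m)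
    σ≡q+q : sum ds ≡ q + q
    σ≡q+q = trans σ≡q*2 (trans (*-comm q 2) (cong (q +_) (+-identityʳ q)))
    labelling : ∃ λ c → partSum c true ds ≡ q
    labelling = subSum (divisors-gapless m doubling) (divisors-distinct (suc m)) q
                       (subst (q ≤_) (sym σ≡q+q) (m≤m+n q q))
    c : ℕ → Bool
    c = proj₁ labelling
    trueSum≡q : partSum c true ds ≡ q
    trueSum≡q = proj₂ labelling
    falseSum≡q : partSum c false ds ≡ q
    falseSum≡q = +-cancelˡ-≡ q _ _ (begin
      q + partSum c false ds                  ≡⟨ cong (_+ partSum c false ds) (sym trueSum≡q) ⟩
      partSum c true ds + partSum c false ds  ≡⟨ partSum-split c ds ⟩
      sum ds                                  ≡⟨ σ≡q+q ⟩
      q + q                                   ∎)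
      where open ≡-Reasoning
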